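{- For all $\lambda$-terms: (1) Merge: if $t\Rightarrow_{\neg w}s\to_w u$ then $t\Rightarrow_{\beta_v}u$. (2) Indexed split: if $t\Rightarrow_{\beta_v}^n s$ then either $t\Rightarrow_{\neg w}s$, or $n>0$ and $t\to_w r\Rightarrow_{\beta_v}^{n-1}s$ for some $r$. (3) Split: if $t\Rightarrow_{\beta_v}s$ then $t\to_w^*r\Rightarrow_{\neg w}s$ for some $r$. Consequently $(\Lambda,\{\to_w,\to_{\neg w}\})$ is a macro-step system with respect to $\Rightarrow_{\beta_v}$ and $\Rightarrow_{\neg w}$.
   Context: $\Lambda$ is the set of $\lambda$-terms $t::=x\mid\lambda x.t\mid ts$ (up to $\alpha$-equivalence); values $v::=x\mid\lambda x.t$; $t\{x:=s\}$ capture-avoiding substitution; $|t|_x$ number of free occurrences of $x$ in $t$. $\to_{\beta_v}$: closure of $(\lambda x.t)v\to_{\beta_v}t\{x:=v\}$ ($v$ a value) under abstraction and both sides of application. $\to_w$: $(\lambda x.t)v\to_w t\{x:=v\}$ ($v$ value); if $t\to_w t'$ then $ts\to_w t's$ and $st\to_w st'$. $\to_{\neg w}$: if $t\to_{\beta_v}s$ then $\lambda x.t\to_{\neg w}\lambda x.s$; if $t\to_{\neg w}t'$ then $ts\to_{\neg w}t's$ and $st\to_{\neg w}st'$. Indexed parallel $\beta_v$, $\Rightarrow_{\beta_v}^n$: $x\Rightarrow_{\beta_v}^0x$; if $t\Rightarrow_{\beta_v}^nt'$ then $\lambda x.t\Rightarrow_{\beta_v}^n\lambda x.t'$; if $t\Rightarrow_{\beta_v}^nt'$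 and $s\Rightarrow_{\beta_v}^ms'$ then $ts\Rightarrow_{\beta_v}^{n+m}t's'$; if $t\Rightarrow_{\beta_v}^nt'$ and $v\Rightarrow_{\beta_v}^mv'$ with $v$ a value then $(\lambda x.t)v\Rightarrow_{\beta_v}^{n+|t'|_x\cdot m+1}t'\{x:=v'\}$. $\Rightarrow_{\beta_v}=\bigcup_n\Rightarrow_{\beta_v}^n$. Parallel non-weak $\Rightarrow_{\neg w}$: $x\Rightarrow_{\neg w}x$; if $t\Rightarrow_{\beta_v}t'$ then $\lambda x.t\Rightarrow_{\neg w}\lambda x.t'$; if $t\Rightarrow_{\neg w}t'$ and $s\Rightarrow_{\neg w}s'$ then $ts\Rightarrow_{\neg w}t's'$. A system $(S,\{\to_e,\to_{\neg e}\})$ is a macro-step system w.r.t. $\Rightarrow,\Rightarrow_{\neg e}$ if $\to_{\neg e}\subseteq\Rightarrow_{\neg e}\subseteq\to_{\neg e}^*$, $t\Rightarrow_{\neg e}\cdot\to_e u$ implies $t\Rightarrow u$, and $t\Rightarrow u$ implies $t\to_e^*\cdot\Rightarrow_{\neg e}u$. -}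

module Defs where

open import Data.Nat using (ℕ; zero; suc; _+_; _*_)
open import Data.Fin using (Fin; zero; suc; _≟_)
open import Data.Product using (Σ; ∃; _×_; _,_)
open import Relation.Nullary using (yes; no)
open import Relation.Binary.Construct.Closure.ReflexiveTransitive using (Star)

-- λ-terms up to α-equivalence: well-scoped de Bruijn terms with n free variables.
data Term (n : ℕ) : Set where
  var : Fin n → Term n
  lam : Term (suc n) → Term n
  app : Term n → Term n → Term n

data Value {n : ℕ} : Term n → Set where
  var : (i : Fin n) → Value (var i)
  lam : (t : Term (suc n)) → Value (lam t)

ext : ∀ {n m} → (Fin n → Fin m) → Fin (suc n) → Fin (suc m)
ext ρ zero    = zero
ext ρ (suc i) = suc (ρ i)

rename : ∀ {n m} → (Fin n → Fin m) → Term n → Term m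
rename ρ (var i)   = var (ρ i)
rename ρ (lam t)   = lam (rename (ext ρ) t)
rename ρ (app t s) = app (rename ρ t) (rename ρ s)

exts : ∀ {n m} → (Fin n → Term m) → Fin (suc n) → Term (suc m)
exts σ zero    = var zero
exts σ (suc i) = rename suc (σ i)

subst : ∀ {n m} → (Fin n → Term m) → Term n → Term m
subst σ (var i)   = σ i
subst σ (lam t)   = lam (subst (exts σ) t)
subst σ (app t s) = app (subst σ t) (subst σ s)

σ₀ : ∀ {n} → Term n → Fin (suc n) → Term n
σ₀ v zero    = v
σ₀ v (suc i) = var i

-- t{x:=v}, where x is the variable bound by the enclosing λ (de Bruijn index 0)
_[_] : ∀ {n} → Term (suc n) → Term n → Term n
t [ v ] = subst (σ₀ v) t

occ : ∀ {n} → Fin n → Term n → ℕ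
occ i (var j) with i ≟ j
... | yes _ = 1
... | no  _ = 0
occ i (lam t)   = occ (suc i) t
occ i (app t s) = occ i t + occ i s

∣_∣₀ : ∀ {n} → Term (suc n) → ℕ
∣ t ∣₀ = occ zero t

infix 4 _→βv_ _→w_ _→¬w_ _⇒βv[_]_ _⇒βv_ _⇒¬w_ _→w*_

data _→βv_ {n : ℕ} : Term n → Term n → Set where
  β   : ∀ {t v} → Value v → app (lam t) v →βv t [ v ]
  lam : ∀ {t s} → t →βv s → lam t →βv lam s
  appL : ∀ {t t' s} → t →βv t' → app t s →βv app t' s
  appR : ∀ {t s s'} → s →βv s' → app t s →βv app t s'

data _→w_ {n : ℕ} : Term n → Term n → Set where
  β    : ∀ {t v} → Value v → app (lam t) v →w t [ v ]
  appL : ∀ {t t' s} → t →w t' → app t s →w app t' s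
  appR : ∀ {t s s'} → s →w s' → app t s →w app t s'

data _→¬w_ {n : ℕ} : Term n → Term n → Set where
  lam  : ∀ {t s} → t →βv s → lam t →¬w lam s
  appL : ∀ {t t' s} → t →¬w t' → app t s →¬w app t' s
  appR : ∀ {t s s'} → s →¬w s' → app t s →¬w app t s'

data _⇒βv[_]_ {n : ℕ} : Term n → ℕ → Term n → Set where
  var : ∀ {i} → var i ⇒βv[ 0 ] var i
  lam : ∀ {t t' k} → t ⇒βv[ k ] t' → lam t ⇒βv[ k ] lam t'
  app : ∀ {t t' s s' k m} → t ⇒βv[ k ] t' → s ⇒βv[ m ] s' →
        app t s ⇒βv[ k + m ] app t' s'
  β   : ∀ {t t' v v' k m} → Value v → t ⇒βv[ k ] t' → v ⇒βv[ m ] v' →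
        app (lam t) v ⇒βv[ k + ∣ t' ∣₀ * m + 1 ] t' [ v' ]

_⇒βv_ : ∀ {n} → Term n → Term n → Set
t ⇒βv s = Σ ℕ (λ k → t ⇒βv[ k ] s)

data _⇒¬w_ {n : ℕ} : Term n → Term n → Set where
  var : ∀ {i} → var i ⇒¬w var i
  lam : ∀ {t t'} → t ⇒βv t' → lam t ⇒¬w lam t'
  app : ∀ {t t' s s'} → t ⇒¬w t' → s ⇒¬w s' → app t s ⇒¬w app t' s'

_→w*_ : ∀ {n} → Term n → Term n → Set
_→w*_ = Star _→w_

record IsMacroStep {S : Set} (_→e_ _→¬e_ _⇒_ _⇒¬e_ : S → S → Set) : Set where
  field
    ¬e⊆⇒¬e  : ∀ {t u} → t →¬e u → t ⇒¬e u
    ⇒¬e⊆¬e* : ∀ {t u} → t ⇒¬e u → Star _→¬e_ t u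
    merge   : ∀ {t s u} → t ⇒¬e s → s →e u → t ⇒ u
    split   : ∀ {t u} → t ⇒ u → ∃ λ r → Star _→e_ t r × r ⇒¬e u

-- A non-weak step leaves every weak redex in place, so the weak step after it fuses with it.
-- For splitting, a step t ⇒βv[k] s either is non-weak already, or contracts some redex
-- (λx.u)v in weak position; firing it first leaves a parallel step of index k − 1, by the
-- substitution lemma  u ⇒βv[k] u', v ⇒βv[m] v'  ⊢  u{x:=v} ⇒βv[k + |u'|ₓ·m] u'{x:=v'}.
-- The index of a simultaneous substitution is tracked by a weighted occurrence count.
module Submission where

open import Defs
open import Data.Nat using (ℕ; _<_; _∸_)
open import Data.Product using (∃; _×_)
open import Data.Sum using (_⊎_)

import Algebra.Properties.CommutativeSemigroup as CommutativeSemigroupProperties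
open import Data.Fin using (Fin; zero; suc; _≟_)
open import Data.Nat using (zero; suc; _+_; _*_; z≤n; s≤s)
open import Data.Nat.Properties
  using (+-identityʳ; +-suc; +-comm; *-distribʳ-+; +-commutativeSemigroup)
open import Data.Nat.Tactic.RingSolver using (solve-∀)
open import Data.Product using (∃₂; _,_; proj₂)
open import Data.Sum using (inj₁; inj₂)
open import Data.Vec.Functional using (_∷_)
open import Function using (_∘_; const)
open import Relation.Nullary using (yes; no)
open import Relation.Binary.PropositionalEquality
  using (_≡_; _≗_; refl; sym; trans; cong; cong₂; module ≡-Reasoning)
open import Relation.Binary.Construct.Closure.ReflexiveTransitive
  using (Star; ε; _◅_; _◅◅_; gmap)

open CommutativeSemigroupProperties +-commutativeSemigroup using (interchange)

private
  variable
    n m l k : ℕ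

ext-cong : {ρ ρ' : Fin n → Fin m} → ρ ≗ ρ' → ext ρ ≗ ext ρ'
ext-cong e zero    = refl
ext-cong e (suc i) = cong suc (e i)

rename-cong : {ρ ρ' : Fin n → Fin m} → ρ ≗ ρ' → rename ρ ≗ rename ρ'
rename-cong e (var i)   = cong var (e i)
rename-cong e (lam t)   = cong lam (rename-cong (ext-cong e) t)
rename-cong e (app t s) = cong₂ app (rename-cong e t) (rename-cong e s)

exts-cong : {σ σ' : Fin n → Term m} → σ ≗ σ' → exts σ ≗ exts σ'
exts-cong e zero    = refl
exts-cong e (suc i) = cong (rename suc) (e i)

subst-cong : {σ σ' : Fin n → Term m} → σ ≗ σ' → subst σ ≗ subst σ'
subst-cong e (var i)   = e i
subst-cong e (lam t)   = cong lam (subst-cong (exts-cong e) t)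
subst-cong e (app t s) = cong₂ app (subst-cong e t) (subst-cong e s)

rename-rename : (ρ : Fin m → Fin l) (ρ' : Fin n → Fin m) →
                rename ρ ∘ rename ρ' ≗ rename (ρ ∘ ρ')
rename-rename ρ ρ' (var i)   = refl
rename-rename ρ ρ' (lam t)   = cong lam (trans (rename-rename (ext ρ) (ext ρ') t)
  (rename-cong (λ { zero → refl ; (suc i) → refl }) t))
rename-rename ρ ρ' (app t s) = cong₂ app (rename-rename ρ ρ' t) (rename-rename ρ ρ' s)

subst-rename : (σ : Fin m → Term l) (ρ : Fin n → Fin m) →
               subst σ ∘ rename ρ ≗ subst (σ ∘ ρ)
subst-rename σ ρ (var i)   = refl
subst-rename σ ρ (lam t)   = cong lam (trans (subst-rename (exts σ) (ext ρ) t)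
  (subst-cong (λ { zero → refl ; (suc i) → refl }) t))
subst-rename σ ρ (app t s) = cong₂ app (subst-rename σ ρ t) (subst-rename σ ρ s)

rename-subst : (ρ : Fin m → Fin l) (σ : Fin n → Term m) →
               rename ρ ∘ subst σ ≗ subst (rename ρ ∘ σ)
rename-subst ρ σ (var i)   = refl
rename-subst ρ σ (lam t)   = cong lam (trans (rename-subst (ext ρ) (exts σ) t)
  (subst-cong (λ { zero → refl
                 ; (suc i) → trans (rename-rename (ext ρ) suc (σ i))
                                   (sym (rename-rename suc ρ (σ i))) }) t))
rename-subst ρ σ (app t s) = cong₂ app (rename-subst ρ σ t) (rename-subst ρ σ s)

subst-subst : (σ : Fin m → Term l) (τ : Fin n → Term m) →
              subst σ ∘ subst τ ≗ subst (subst σ ∘ τ)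
subst-subst σ τ (var i)   = refl
subst-subst σ τ (lam t)   = cong lam (trans (subst-subst (exts σ) (exts τ) t)
  (subst-cong (λ { zero → refl
                 ; (suc i) → trans (subst-rename (exts σ) suc (τ i))
                                   (sym (rename-subst suc σ (τ i))) }) t))
subst-subst σ τ (app t s) = cong₂ app (subst-subst σ τ t) (subst-subst σ τ s)

subst-var : (t : Term n) → subst var t ≡ t
subst-var (var i)   = refl
subst-var (lam t)   = cong lam (trans (subst-cong (λ { zero → refl ; (suc i) → refl }) t)
                                      (subst-var t))
subst-var (app t s) = cong₂ app (subst-var t) (subst-var s)

subst-[] : (σ : Fin n → Term m) (t : Term (suc n)) (v : Term n) →
           subst σ (t [ v ]) ≡ subst (exts σ) t [ subst σ v ]
subst-[] σ t v = begin
  subst σ (t [ v ])                            ≡⟨ subst-subst σ (σ₀ v) t ⟩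
  subst (subst σ ∘ σ₀ v) t                     ≡⟨ subst-cong pointwise t ⟩
  subst (subst (σ₀ (subst σ v)) ∘ exts σ) t    ≡⟨ subst-subst (σ₀ (subst σ v)) (exts σ) t ⟨
  subst (exts σ) t [ subst σ v ]               ∎
  where
  open ≡-Reasoning
  pointwise : subst σ ∘ σ₀ v ≗ subst (σ₀ (subst σ v)) ∘ exts σ
  pointwise zero    = refl
  pointwise (suc i) = sym (trans (subst-rename (σ₀ (subst σ v)) suc (σ i)) (subst-var (σ i)))

rename-[] : (ρ : Fin n → Fin m) (t : Term (suc n)) (v : Term n) →
            rename ρ (t [ v ]) ≡ rename (ext ρ) t [ rename ρ v ]
rename-[] ρ t v = begin
  rename ρ (t [ v ])                           ≡⟨ rename-subst ρ (σ₀ v) t ⟩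
  subst (rename ρ ∘ σ₀ v) t                    ≡⟨ subst-cong (λ { zero → refl ; (suc i) → refl }) t ⟩
  subst (σ₀ (rename ρ v) ∘ ext ρ) t            ≡⟨ subst-rename (σ₀ (rename ρ v)) (ext ρ) t ⟨
  rename (ext ρ) t [ rename ρ v ]              ∎
  where open ≡-Reasoning

Value-rename : (ρ : Fin n → Fin m) {v : Term n} → Value v → Value (rename ρ v)
Value-rename ρ (var i) = var (ρ i)
Value-rename ρ (lam t) = lam _

exts-Value : {σ : Fin n → Term m} → (∀ i → Value (σ i)) → ∀ i → Value (exts σ i)
exts-Value σ-values zero    = var zero
exts-Value σ-values (suc i) = Value-rename suc (σ-values i)

Value-subst : {σ : Fin n → Term m} → (∀ i → Value (σ i)) →
              {v : Term n} → Value v → Value (subst σ v)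
Value-subst σ-values (var i) = σ-values i
Value-subst σ-values (lam t) = lam _

-- weight μ t = Σᵢ μ i · occ i t
weight : (Fin n → ℕ) → Term n → ℕ
weight μ (var i)   = μ i
weight μ (lam t)   = weight (0 ∷ μ) t
weight μ (app t s) = weight μ t + weight μ s

weight-cong : {μ ν : Fin n → ℕ} → μ ≗ ν → weight μ ≗ weight ν
weight-cong e (var i)   = e i
weight-cong e (lam t)   = weight-cong (λ { zero → refl ; (suc i) → e i }) t
weight-cong e (app t s) = cong₂ _+_ (weight-cong e t) (weight-cong e s)

weight-rename : (μ : Fin m → ℕ) (ρ : Fin n → Fin m) →
                weight μ ∘ rename ρ ≗ weight (μ ∘ ρ)
weight-rename μ ρ (var i)   = refl
weight-rename μ ρ (lam t)   = trans (weight-rename (0 ∷ μ) (ext ρ) t)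
  (weight-cong (λ { zero → refl ; (suc i) → refl }) t)
weight-rename μ ρ (app t s) = cong₂ _+_ (weight-rename μ ρ t) (weight-rename μ ρ s)

weight-subst : (μ : Fin m → ℕ) (σ : Fin n → Term m) →
               weight μ ∘ subst σ ≗ weight (weight μ ∘ σ)
weight-subst μ σ (var i)   = refl
weight-subst μ σ (lam t)   = trans (weight-subst (0 ∷ μ) (exts σ) t)
  (weight-cong (λ { zero → refl ; (suc i) → weight-rename (0 ∷ μ) suc (σ i) }) t)
weight-subst μ σ (app t s) = cong₂ _+_ (weight-subst μ σ t) (weight-subst μ σ s)

weight-+ : (μ ν : Fin n → ℕ) (t : Term n) →
           weight (λ i → μ i + ν i) t ≡ weight μ t + weight ν t
weight-+ μ ν (var i)   = refl
weight-+ μ ν (lam t)   = trans (weight-cong (λ { zero → refl ; (suc i) → refl }) t)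
                               (weight-+ (0 ∷ μ) (0 ∷ ν) t)
weight-+ μ ν (app t s) = trans (cong₂ _+_ (weight-+ μ ν t) (weight-+ μ ν s))
                               (interchange (weight μ t) (weight ν t) (weight μ s) (weight ν s))

weight-* : (μ : Fin n → ℕ) (c : ℕ) (t : Term n) →
           weight (λ i → μ i * c) t ≡ weight μ t * c
weight-* μ c (var i)   = refl
weight-* μ c (lam t)   = trans (weight-cong (λ { zero → refl ; (suc i) → refl }) t)
                               (weight-* (0 ∷ μ) c t)
weight-* μ c (app t s) = trans (cong₂ _+_ (weight-* μ c t) (weight-* μ c s))
                               (sym (*-distribʳ-+ c (weight μ t) (weight μ s)))

weight-0 : (t : Term n) → weight (const 0) t ≡ 0
weight-0 (var i)   = refl
weight-0 (lam t)   = trans (weight-cong (λ { zero → refl ; (suc i) → refl }) t) (weight-0 t)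
weight-0 (app t s) = cong₂ _+_ (weight-0 t) (weight-0 s)

δ : Fin n → Fin n → ℕ
δ j i = occ j (var i)

δ-suc : (j i : Fin n) → δ (suc j) (suc i) ≡ δ j i
δ-suc j i with j ≟ i
... | yes _ = refl
... | no  _ = refl

occ≡weight : (j : Fin n) (t : Term n) → occ j t ≡ weight (δ j) t
occ≡weight j (var i)   = refl
occ≡weight j (lam t)   = trans (occ≡weight (suc j) t)
  (weight-cong (λ { zero → refl ; (suc i) → δ-suc j i }) t)
occ≡weight j (app t s) = cong₂ _+_ (occ≡weight j t) (occ≡weight j s)

weight-∷ : (c : ℕ) (μ : Fin n → ℕ) (t : Term (suc n)) →
           weight (c ∷ μ) t ≡ weight (0 ∷ μ) t + ∣ t ∣₀ * c
weight-∷ c μ t = begin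
  weight (c ∷ μ) t
    ≡⟨ weight-cong split t ⟩
  weight (λ i → (0 ∷ μ) i + δ zero i * c) t
    ≡⟨ weight-+ (0 ∷ μ) _ t ⟩
  weight (0 ∷ μ) t + weight (λ i → δ zero i * c) t
    ≡⟨ cong (weight (0 ∷ μ) t +_) (weight-* (δ zero) c t) ⟩
  weight (0 ∷ μ) t + weight (δ zero) t * c
    ≡⟨ cong (λ x → weight (0 ∷ μ) t + x * c) (occ≡weight zero t) ⟨
  weight (0 ∷ μ) t + ∣ t ∣₀ * c
    ∎
  where
  open ≡-Reasoning
  split : c ∷ μ ≗ λ i → (0 ∷ μ) i + δ zero i * c
  split zero    = sym (+-identityʳ c)
  split (suc i) = sym (+-identityʳ (μ i))

weight-[] : (μ : Fin n → ℕ) (t : Term (suc n)) (v : Term n) →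
            weight μ (t [ v ]) ≡ weight (0 ∷ μ) t + ∣ t ∣₀ * weight μ v
weight-[] μ t v = begin
  weight μ (t [ v ])                      ≡⟨ weight-subst μ (σ₀ v) t ⟩
  weight (weight μ ∘ σ₀ v) t              ≡⟨ weight-cong (λ { zero → refl ; (suc i) → refl }) t ⟩
  weight (weight μ v ∷ μ) t               ≡⟨ weight-∷ (weight μ v) μ t ⟩
  weight (0 ∷ μ) t + ∣ t ∣₀ * weight μ v  ∎
  where open ≡-Reasoning

∣rename-ext∣₀ : (ρ : Fin n → Fin m) (t : Term (suc n)) → ∣ rename (ext ρ) t ∣₀ ≡ ∣ t ∣₀
∣rename-ext∣₀ ρ t = begin
  occ zero (rename (ext ρ) t)         ≡⟨ occ≡weight zero (rename (ext ρ) t) ⟩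
  weight (δ zero) (rename (ext ρ) t)  ≡⟨ weight-rename (δ zero) (ext ρ) t ⟩
  weight (δ zero ∘ ext ρ) t           ≡⟨ weight-cong (λ { zero → refl ; (suc i) → refl }) t ⟩
  weight (δ zero) t                   ≡⟨ occ≡weight zero t ⟨
  occ zero t                          ∎
  where open ≡-Reasoning

∣subst-exts∣₀ : (σ : Fin n → Term m) (t : Term (suc n)) → ∣ subst (exts σ) t ∣₀ ≡ ∣ t ∣₀
∣subst-exts∣₀ σ t = begin
  occ zero (subst (exts σ) t)          ≡⟨ occ≡weight zero (subst (exts σ) t) ⟩
  weight (δ zero) (subst (exts σ) t)   ≡⟨ weight-subst (δ zero) (exts σ) t ⟩
  weight (weight (δ zero) ∘ exts σ) t  ≡⟨ weight-cong pointwise t ⟩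
  weight (δ zero) t                    ≡⟨ occ≡weight zero t ⟨
  occ zero t                           ∎
  where
  open ≡-Reasoning
  pointwise : weight (δ zero) ∘ exts σ ≗ δ zero
  pointwise zero    = refl
  pointwise (suc i) = trans (weight-rename (δ zero) suc (σ i)) (weight-0 (σ i))

⇒βv-cast : {t s s' : Term n} {k k' : ℕ} → k ≡ k' → s ≡ s' → t ⇒βv[ k ] s → t ⇒βv[ k' ] s'
⇒βv-cast refl refl d = d

⇒βv-refl : (t : Term n) → t ⇒βv[ 0 ] t
⇒βv-refl (var i)   = var
⇒βv-refl (lam t)   = lam (⇒βv-refl t)
⇒βv-refl (app t s) = app (⇒βv-refl t) (⇒βv-refl s)

⇒βv-preserves-Value : {v v' : Term n} → v ⇒βv[ k ] v' → Value v → Value v'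
⇒βv-preserves-Value var     (var i) = var _
⇒βv-preserves-Value (lam _) (lam t) = lam _

rename-⇒βv : (ρ : Fin n → Fin m) {t t' : Term n} →
             t ⇒βv[ k ] t' → rename ρ t ⇒βv[ k ] rename ρ t'
rename-⇒βv ρ var       = var
rename-⇒βv ρ (lam d)   = lam (rename-⇒βv (ext ρ) d)
rename-⇒βv ρ (app d e) = app (rename-⇒βv ρ d) (rename-⇒βv ρ e)
rename-⇒βv ρ (β {t' = t'} {v' = v'} {k = k} {m = m} v-value d e) =
  ⇒βv-cast (cong (λ c → k + c * m + 1) (∣rename-ext∣₀ ρ t')) (sym (rename-[] ρ t' v'))
    (β (Value-rename ρ v-value) (rename-⇒βv (ext ρ) d) (rename-⇒βv ρ e))

exts-⇒βv : {σ σ' : Fin n → Term m} {μ : Fin n → ℕ} → (∀ i → σ i ⇒βv[ μ i ] σ' i) →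
           ∀ i → exts σ i ⇒βv[ (0 ∷ μ) i ] exts σ' i
exts-⇒βv σ⇒σ' zero    = var
exts-⇒βv σ⇒σ' (suc i) = rename-⇒βv suc (σ⇒σ' i)

-- Each free occurrence of i in t' is replaced by a copy of σ' i, which costs μ i steps.
subst-⇒βv : {σ σ' : Fin n → Term m} {μ : Fin n → ℕ} →
            (∀ i → Value (σ i)) → (∀ i → σ i ⇒βv[ μ i ] σ' i) →
            {t t' : Term n} → t ⇒βv[ k ] t' → subst σ t ⇒βv[ k + weight μ t' ] subst σ' t'
subst-⇒βv σ-values σ⇒σ' (var {i = i}) = σ⇒σ' i
subst-⇒βv σ-values σ⇒σ' (lam d) =
  lam (subst-⇒βv (exts-Value σ-values) (exts-⇒βv σ⇒σ') d)
subst-⇒βv {μ = μ} σ-values σ⇒σ' (app {t' = t'} {s' = s'} {k = k} {m = m} d e) =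
  ⇒βv-cast (interchange k (weight μ t') m (weight μ s')) refl
    (app (subst-⇒βv σ-values σ⇒σ' d) (subst-⇒βv σ-values σ⇒σ' e))
subst-⇒βv {σ' = σ'} {μ = μ} σ-values σ⇒σ'
          (β {t' = t'} {v' = v'} {k = k} {m = m} v-value d e) =
  ⇒βv-cast index (sym (subst-[] σ' t' v'))
    (β (Value-subst σ-values v-value)
       (subst-⇒βv (exts-Value σ-values) (exts-⇒βv σ⇒σ') d)
       (subst-⇒βv σ-values σ⇒σ' e))
  where
  open ≡-Reasoning
  rearrange : ∀ k a c m b → k + a + c * (m + b) + 1 ≡ k + c * m + 1 + (a + c * b)
  rearrange = solve-∀
  a = weight (0 ∷ μ) t'
  b = weight μ v'
  index : k + a + ∣ subst (exts σ') t' ∣₀ * (m + b) + 1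
        ≡ k + ∣ t' ∣₀ * m + 1 + weight μ (t' [ v' ])
  index = begin
    k + a + ∣ subst (exts σ') t' ∣₀ * (m + b) + 1
      ≡⟨ cong (λ c → k + a + c * (m + b) + 1) (∣subst-exts∣₀ σ' t') ⟩
    k + a + ∣ t' ∣₀ * (m + b) + 1
      ≡⟨ rearrange k a ∣ t' ∣₀ m b ⟩
    k + ∣ t' ∣₀ * m + 1 + (a + ∣ t' ∣₀ * b)
      ≡⟨ cong (k + ∣ t' ∣₀ * m + 1 +_) (weight-[] μ t' v') ⟨
    k + ∣ t' ∣₀ * m + 1 + weight μ (t' [ v' ]) ∎

[]-⇒βv : {t t' : Term (suc n)} {v v' : Term n} {k m : ℕ} → Value v →
         t ⇒βv[ k ] t' → v ⇒βv[ m ] v' → t [ v ] ⇒βv[ k + ∣ t' ∣₀ * m ] t' [ v' ]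
[]-⇒βv {t' = t'} {k = k} {m = m} v-value d e =
  ⇒βv-cast (cong (k +_) weight-single) refl
    (subst-⇒βv {μ = m ∷ const 0} σ₀-values σ₀⇒σ₀ d)
  where
  σ₀-values : ∀ i → Value (σ₀ _ i)
  σ₀-values zero    = v-value
  σ₀-values (suc i) = var i
  σ₀⇒σ₀ : ∀ i → σ₀ _ i ⇒βv[ (m ∷ const 0) i ] σ₀ _ i
  σ₀⇒σ₀ zero    = e
  σ₀⇒σ₀ (suc i) = var
  weight-single : weight (m ∷ const 0) t' ≡ ∣ t' ∣₀ * m
  weight-single = trans (weight-∷ m (const 0) t')
    (cong (_+ ∣ t' ∣₀ * m) (trans (weight-cong (λ { zero → refl ; (suc i) → refl }) t')
                                  (weight-0 t')))

⇒βv⊆→βv* : {t s : Term n} → t ⇒βv[ k ] s → Star _→βv_ t s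
⇒βv⊆→βv* var       = ε
⇒βv⊆→βv* (lam d)   = gmap lam lam (⇒βv⊆→βv* d)
⇒βv⊆→βv* (app d e) =
  gmap (λ t → app t _) appL (⇒βv⊆→βv* d) ◅◅ gmap (app _) appR (⇒βv⊆→βv* e)
⇒βv⊆→βv* (β v-value d e) =
  gmap (λ t → app (lam t) _) (λ st → appL (lam st)) (⇒βv⊆→βv* d)
  ◅◅ gmap (app _) appR (⇒βv⊆→βv* e)
  ◅◅ β (⇒βv-preserves-Value e v-value) ◅ ε

app-⇒βv : {t t' s s' : Term n} → t ⇒βv t' → s ⇒βv s' → app t s ⇒βv app t' s'
app-⇒βv (_ , d) (_ , e) = _ , app d e

→βv⊆⇒βv : {t s : Term n} → t →βv s → t ⇒βv s
→βv⊆⇒βv (β {t = t} v-value) = _ , β v-value (⇒βv-refl t) (⇒βv-refl _)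
→βv⊆⇒βv (lam st) with →βv⊆⇒βv st
... | k , d = k , lam d
→βv⊆⇒βv (appL {s = s} st) = app-⇒βv (→βv⊆⇒βv st) (0 , ⇒βv-refl s)
→βv⊆⇒βv (appR {t = t} st) = app-⇒βv (0 , ⇒βv-refl t) (→βv⊆⇒βv st)

⇒¬w-refl : (t : Term n) → t ⇒¬w t
⇒¬w-refl (var i)   = var
⇒¬w-refl (lam t)   = lam (0 , ⇒βv-refl t)
⇒¬w-refl (app t s) = app (⇒¬w-refl t) (⇒¬w-refl s)

→¬w⊆⇒¬w : {t s : Term n} → t →¬w s → t ⇒¬w s
→¬w⊆⇒¬w (lam st)          = lam (→βv⊆⇒βv st)
→¬w⊆⇒¬w (appL {s = s} st) = app (→¬w⊆⇒¬w st) (⇒¬w-refl s)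
→¬w⊆⇒¬w (appR {t = t} st) = app (⇒¬w-refl t) (→¬w⊆⇒¬w st)

⇒¬w⊆→¬w* : {t s : Term n} → t ⇒¬w s → Star _→¬w_ t s
⇒¬w⊆→¬w* var           = ε
⇒¬w⊆→¬w* (lam (_ , d)) = gmap lam lam (⇒βv⊆→βv* d)
⇒¬w⊆→¬w* (app p q)     =
  gmap (λ t → app t _) appL (⇒¬w⊆→¬w* p) ◅◅ gmap (app _) appR (⇒¬w⊆→¬w* q)

⇒¬w⊆⇒βv : {t s : Term n} → t ⇒¬w s → t ⇒βv s
⇒¬w⊆⇒βv var           = 0 , var
⇒¬w⊆⇒βv (lam (k , d)) = k , lam d
⇒¬w⊆⇒βv (app p q)     = app-⇒βv (⇒¬w⊆⇒βv p) (⇒¬w⊆⇒βv q)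

⇒¬w-reflects-Value : {v v' : Term n} → v ⇒¬w v' → Value v' → Value v
⇒¬w-reflects-Value var     (var i) = var _
⇒¬w-reflects-Value (lam _) (lam t) = lam _

⇒¬w-→w-merge : {t s u : Term n} → t ⇒¬w s → s →w u → t ⇒βv u
⇒¬w-→w-merge (app (lam (_ , d)) p) (β v-value) =
  _ , β (⇒¬w-reflects-Value p v-value) d (proj₂ (⇒¬w⊆⇒βv p))
⇒¬w-→w-merge (app p q) (appL st) = app-⇒βv (⇒¬w-→w-merge p st) (⇒¬w⊆⇒βv q)
⇒¬w-→w-merge (app p q) (appR st) = app-⇒βv (⇒¬w⊆⇒βv p) (⇒¬w-→w-merge q st)

-- A redex contracted in weak position is fired first; it accounts for exactly one unit of the index.
⇒βv-weak-step-or-¬w : {t s : Term n} → t ⇒βv[ k ] s →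
                      t ⇒¬w s ⊎ ∃₂ λ k' r → k ≡ suc k' × t →w r × r ⇒βv[ k' ] s
⇒βv-weak-step-or-¬w var     = inj₁ var
⇒βv-weak-step-or-¬w (lam d) = inj₁ (lam (_ , d))
⇒βv-weak-step-or-¬w (app {k = k} d e) with ⇒βv-weak-step-or-¬w d | ⇒βv-weak-step-or-¬w e
... | inj₂ (_ , _ , refl , st , d') | _ = inj₂ (_ , _ , refl , appL st , app d' e)
... | inj₁ _ | inj₂ (m' , _ , refl , st , e') = inj₂ (_ , _ , +-suc k m' , appR st , app d e')
... | inj₁ p | inj₁ q = inj₁ (app p q)
⇒βv-weak-step-or-¬w (β v-value d e) =
  inj₂ (_ , _ , +-comm _ 1 , β v-value , []-⇒βv v-value d e)

⇒βv-indexed-split : {t s : Term n} → t ⇒βv[ k ] s →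
                    t ⇒¬w s ⊎ (0 < k × ∃ λ r → t →w r × r ⇒βv[ k ∸ 1 ] s)
⇒βv-indexed-split d with ⇒βv-weak-step-or-¬w d
... | inj₁ p                        = inj₁ p
... | inj₂ (_ , r , refl , st , d') = inj₂ (s≤s z≤n , r , st , d')

⇒βv[]-split : ∀ k {t s : Term n} → t ⇒βv[ k ] s → ∃ λ r → t →w* r × r ⇒¬w s
⇒βv[]-split k d with ⇒βv-weak-step-or-¬w d
... | inj₁ p = _ , ε , p
... | inj₂ (k' , _ , refl , st , d') with ⇒βv[]-split k' d'
...   | r , sts , p = r , st ◅ sts , p

⇒βv-split : {t s : Term n} → t ⇒βv s → ∃ λ r → t →w* r × r ⇒¬w s
⇒βv-split (k , d) = ⇒βv[]-split k d

proposition4 :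
    (∀ {n} {t s u : Term n} → t ⇒¬w s → s →w u → t ⇒βv u)
    × (∀ {n k} {t s : Term n} → t ⇒βv[ k ] s →
         t ⇒¬w s ⊎ (0 < k × ∃ λ r → t →w r × r ⇒βv[ k ∸ 1 ] s))
    × (∀ {n} {t s : Term n} → t ⇒βv s → ∃ λ r → t →w* r × r ⇒¬w s)
    × (∀ n → IsMacroStep {Term n} _→w_ _→¬w_ _⇒βv_ _⇒¬w_)
proposition4 = ⇒¬w-→w-merge , ⇒βv-indexed-split , ⇒βv-split , λ n → record
  { ¬e⊆⇒¬e  = →¬w⊆⇒¬w
  ; ⇒¬e⊆¬e* = ⇒¬w⊆→¬w*
  ; merge   = ⇒¬w-→w-merge
  ; split   = ⇒βv-split
  }
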